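{- Let $\delta$ be a proof of PCMLL in normal form of a sequent $\Gamma\vdash C$. Then every formula of every sequent of $\delta$ is a sub-formula of some formula of $\Gamma$ or of $C$.
   Context: PCMLL (de Groote's partially commutative intuitionistic multiplicative linear logic) in natural deduction, sequent style. Formulas are built from propositional variables with $\otimes$ (commutative product), $\odot$ (non-commutative product), $\multimap$ (commutative implication), $\backslash$ and $/$ (non-commutative implications). Contexts are finite multisets of formula occurrences with a series–parallel partial order, written with $(\Gamma,\Delta)$ (disjoint union, no order between parts) and $\langle\Gamma;\Delta\rangle$ (all of $\Gamma$ before all of $\Delta$), identified up to equality as partially ordered multisets; $\Gamma[\Delta]$ denotes filling a hole. Rules: axiom $A\vdash A$; $\backslash_e$: $\Gamma\vdash A$, $\Delta\vdash A\backslash C$ give $\langle\Gamma;\Delta\rangle\vdash C$; $/_e$: $\Delta\vdash C/A$, $\Gamma\vdash A$ give $\langle\Delta;\Gamma\rangle\vdash C$; $\multimap_e$: $\Gamma\vdash A$, $\Delta\vdash A\multimap C$ give $(\Gamma,\Delta)\vdash C$; $\backslash_i$: $\langle A;\Gamma\rangle\vdash C$ gives $\Gamma\vdash A\backslash C$; $/_i$: $\langle\Gamma;A\rangle\vdash C$ gives $\Gamma\vdash C/A$; $\multimap_i$: $(A,\Gamma)\vdash C$ gives $\Gamma\vdash A\multimap C$; $\odot_i$: $\Delta\vdash A$, $\Gamma\vdash B$ give $\langle\Delta;\Gamma\rangle\vdash A\odot B$; $\otimes_i$: same giving $(\Delta,\Gamma)\vdash A\otimes B$; $\odot_e$: $\Delta\vdash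 A\odot B$ and $\Gamma[\langle A;B\rangle]\vdash C$ give $\Gamma[\Delta]\vdash C$; $\otimes_e$: $\Delta\vdash A\otimes B$ and $\Gamma[(A,B)]\vdash C$ give $\Gamma[\Delta]\vdash C$ (the occurrences $A,B$ being equivalent in the order, $A<B$ for $\odot_e$, incomparable for $\otimes_e$); entropy: $\Gamma\vdash C$ gives $\Gamma'\vdash C$ whenever $\Gamma'$ has the same multiset as $\Gamma$ and its order is included in that of $\Gamma$. Principal branch $B(S_0)$: smallest set containing $S_0$ such that for $S\in B(S_0)$: if concluded by a unary rule its premise is in it; if by a product elimination, the premise $\Gamma[\langle A;B\rangle]\vdash C$ (resp. $\Gamma[(A,B)]\vdash C$) is in it; if by an implication elimination, the premise carrying the implication is in it. Redexes: an introduction whose conclusion is the premise carrying the main connective of an immediately following elimination of the same connective; and a product elimination whose premise $\langle A;B\rangle\vdash A\odot B$ (resp. $(A,B)\vdash A\otimes B$) is concluded by the introduction from axioms. A $k$-extended-redex: for an elimination rule with major premise $S_0$ (premise whose right-hand formula has the eliminated connective as main connective), a path $S_0,\dots,S_k$ in $B(S_0)$ (each $S_{i+1}$ the premise in $B(S_0)$ of the rule concluding $S_i$) with $S_k$ the conclusion of an introduction rule and $S_0,S_k$ having the same right-hand formula. A proof is in normal form if it contains no $k$-extended-redex for any $k\ge0$. -}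

module Defs where

open import Data.Nat using (ℕ)
open import Data.Product using (Σ; Σ-syntax; _×_; _,_; ∃-syntax)
open import Data.Sum using (_⊎_)
open import Relation.Binary.PropositionalEquality using (_≡_)
open import Relation.Binary.Construct.Closure.ReflexiveTransitive using (Star)
open import Relation.Nullary using (¬_)

-- Formulas of PCMLL
--   A ⊗ B  commutative product      A ⊙ B  non-commutative product
--   A ⊸ C  commutative implication
--   A ⧹ C  (paper: A \ C)           C ⧸ A  (paper: C / A)

infixr 6 _⊗_ _⊙_
infixr 5 _⊸_ _⧹_
infixl 5 _⧸_

data Formula : Set where
  var : ℕ → Formula
  _⊗_ _⊙_ _⊸_ _⧹_ _⧸_ : Formula → Formula → Formula

data _⊑f_ : Formula → Formula → Set where
  sf-refl : ∀ {A} → A ⊑f A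
  sf-⊗l : ∀ {A B C} → A ⊑f B → A ⊑f (B ⊗ C)
  sf-⊗r : ∀ {A B C} → A ⊑f C → A ⊑f (B ⊗ C)
  sf-⊙l : ∀ {A B C} → A ⊑f B → A ⊑f (B ⊙ C)
  sf-⊙r : ∀ {A B C} → A ⊑f C → A ⊑f (B ⊙ C)
  sf-⊸l : ∀ {A B C} → A ⊑f B → A ⊑f (B ⊸ C)
  sf-⊸r : ∀ {A B C} → A ⊑f C → A ⊑f (B ⊸ C)
  sf-⧹l : ∀ {A B C} → A ⊑f B → A ⊑f (B ⧹ C)
  sf-⧹r : ∀ {A B C} → A ⊑f C → A ⊑f (B ⧹ C)
  sf-⧸l : ∀ {A B C} → A ⊑f B → A ⊑f (B ⧸ C)
  sf-⧸r : ∀ {A B C} → A ⊑f C → A ⊑f (B ⧸ C)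

-- Contexts: series-parallel terms denoting partially ordered multisets.
--   (Γ ,, Δ)   disjoint union, no order between the parts      (paper: (Γ,Δ))
--   ⟨ Γ ⨾ Δ ⟩  all of Γ before all of Δ                         (paper: ⟨Γ;Δ⟩)

infixr 4 _,,_

data Ctx : Set where
  ε     : Ctx
  [_]   : Formula → Ctx
  _,,_  : Ctx → Ctx → Ctx
  ⟨_⨾_⟩ : Ctx → Ctx → Ctx

data Pos : Ctx → Set where
  here : ∀ {A} → Pos [ A ]
  parL : ∀ {Γ Δ} → Pos Γ → Pos (Γ ,, Δ)
  parR : ∀ {Γ Δ} → Pos Δ → Pos (Γ ,, Δ)
  seqL : ∀ {Γ Δ} → Pos Γ → Pos ⟨ Γ ⨾ Δ ⟩
  seqR : ∀ {Γ Δ} → Pos Δ → Pos ⟨ Γ ⨾ Δ ⟩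

lbl : ∀ {Γ} → Pos Γ → Formula
lbl (here {A}) = A
lbl (parL p) = lbl p
lbl (parR p) = lbl p
lbl (seqL p) = lbl p
lbl (seqR p) = lbl p

data _≺_ : ∀ {Γ} → Pos Γ → Pos Γ → Set where
  seq-LR : ∀ {Γ Δ} {p : Pos Γ} {q : Pos Δ} → seqL {Γ} {Δ} p ≺ seqR q
  seq-LL : ∀ {Γ Δ} {p q : Pos Γ} → p ≺ q → seqL {Γ} {Δ} p ≺ seqL q
  seq-RR : ∀ {Γ Δ} {p q : Pos Δ} → p ≺ q → seqR {Γ} {Δ} p ≺ seqR q
  par-LL : ∀ {Γ Δ} {p q : Pos Γ} → p ≺ q → parL {Γ} {Δ} p ≺ parL q
  par-RR : ∀ {Γ Δ} {p q : Pos Δ} → p ≺ q → parR {Γ} {Δ} p ≺ parR q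

record _⊑_ (Θ Γ : Ctx) : Set where
  field
    to      : Pos Θ → Pos Γ
    from    : Pos Γ → Pos Θ
    from-to : ∀ p → from (to p) ≡ p
    to-from : ∀ q → to (from q) ≡ q
    lbl-to  : ∀ p → lbl (to p) ≡ lbl p
    mono    : ∀ {p q} → p ≺ q → to p ≺ to q

record _≅_ (Θ Γ : Ctx) : Set where
  field
    incl    : Θ ⊑ Γ
  open _⊑_ incl
  field
    reflect : ∀ {p q} → to p ≺ to q → p ≺ q

infix 4 _≅_ _⊑_
infix 8 _[_]□

data Ctx□ : Set where
  □     : Ctx□
  parL□ : Ctx□ → Ctx → Ctx□
  parR□ : Ctx → Ctx□ → Ctx□
  seqL□ : Ctx□ → Ctx → Ctx□
  seqR□ : Ctx → Ctx□ → Ctx□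

_[_]□ : Ctx□ → Ctx → Ctx
□ [ Δ ]□ = Δ
parL□ Γ Ξ [ Δ ]□ = (Γ [ Δ ]□) ,, Ξ
parR□ Ξ Γ [ Δ ]□ = Ξ ,, (Γ [ Δ ]□)
seqL□ Γ Ξ [ Δ ]□ = ⟨ Γ [ Δ ]□ ⨾ Ξ ⟩
seqR□ Ξ Γ [ Δ ]□ = ⟨ Ξ ⨾ Γ [ Δ ]□ ⟩

-- Since contexts are identified up to equality
-- of partially ordered multisets, the conclusion context Θ of each rule is
-- any context equal (≅) to the one prescribed by the rule (premises may be
-- taken in the displayed shape w.l.o.g., as their own conclusions are
-- already taken up to ≅; for unary introductions the conclusion context is
-- a free variable).

infix 2 _⊢_

data _⊢_ : Ctx → Formula → Set where
  ax  : ∀ {Θ A} → Θ ≅ [ A ] → Θ ⊢ A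
  ⧹e  : ∀ {Θ Γ Δ A C} → Γ ⊢ A → Δ ⊢ A ⧹ C → Θ ≅ ⟨ Γ ⨾ Δ ⟩ → Θ ⊢ C
  ⧸e  : ∀ {Θ Γ Δ A C} → Δ ⊢ C ⧸ A → Γ ⊢ A → Θ ≅ ⟨ Δ ⨾ Γ ⟩ → Θ ⊢ C
  ⊸e  : ∀ {Θ Γ Δ A C} → Γ ⊢ A → Δ ⊢ A ⊸ C → Θ ≅ (Γ ,, Δ) → Θ ⊢ C
  ⧹i  : ∀ {Γ A C} → ⟨ [ A ] ⨾ Γ ⟩ ⊢ C → Γ ⊢ A ⧹ C
  ⧸i  : ∀ {Γ A C} → ⟨ Γ ⨾ [ A ] ⟩ ⊢ C → Γ ⊢ C ⧸ A
  ⊸i  : ∀ {Γ A C} → ([ A ] ,, Γ) ⊢ C → Γ ⊢ A ⊸ C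
  ⊙i  : ∀ {Θ Γ Δ A B} → Δ ⊢ A → Γ ⊢ B → Θ ≅ ⟨ Δ ⨾ Γ ⟩ → Θ ⊢ A ⊙ B
  ⊗i  : ∀ {Θ Γ Δ A B} → Δ ⊢ A → Γ ⊢ B → Θ ≅ (Δ ,, Γ) → Θ ⊢ A ⊗ B
  ⊙e  : ∀ {Θ Δ A B C} (Γ : Ctx□) → Δ ⊢ A ⊙ B → Γ [ ⟨ [ A ] ⨾ [ B ] ⟩ ]□ ⊢ C
        → Θ ≅ Γ [ Δ ]□ → Θ ⊢ C
  ⊗e  : ∀ {Θ Δ A B C} (Γ : Ctx□) → Δ ⊢ A ⊗ B → Γ [ [ A ] ,, [ B ] ]□ ⊢ C
        → Θ ≅ Γ [ Δ ]□ → Θ ⊢ C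
  ent : ∀ {Θ Γ C} → Γ ⊢ C → Θ ⊑ Γ → Θ ⊢ C

-- a sequent occurrence in a proof, i.e. a (sub)proof together with its sequent
Deriv : Set
Deriv = Σ[ Γ ∈ Ctx ] Σ[ C ∈ Formula ] (Γ ⊢ C)

⌜_⌝ : ∀ {Γ C} → Γ ⊢ C → Deriv
⌜_⌝ {Γ} {C} d = Γ , C , d

rhs : Deriv → Formula
rhs (_ , C , _) = C

data Premise : Deriv → Deriv → Set where
  ⧹e₁ : ∀ {Θ Γ Δ A C} (d : Γ ⊢ A) (e : Δ ⊢ A ⧹ C) (i : Θ ≅ ⟨ Γ ⨾ Δ ⟩) → Premise ⌜ d ⌝ ⌜ ⧹e d e i ⌝
  ⧹e₂ : ∀ {Θ Γ Δ A C} (d : Γ ⊢ A) (e : Δ ⊢ A ⧹ C) (i : Θ ≅ ⟨ Γ ⨾ Δ ⟩) → Premise ⌜ e ⌝ ⌜ ⧹e d e i ⌝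
  ⧸e₁ : ∀ {Θ Γ Δ A C} (e : Δ ⊢ C ⧸ A) (d : Γ ⊢ A) (i : Θ ≅ ⟨ Δ ⨾ Γ ⟩) → Premise ⌜ e ⌝ ⌜ ⧸e e d i ⌝
  ⧸e₂ : ∀ {Θ Γ Δ A C} (e : Δ ⊢ C ⧸ A) (d : Γ ⊢ A) (i : Θ ≅ ⟨ Δ ⨾ Γ ⟩) → Premise ⌜ d ⌝ ⌜ ⧸e e d i ⌝
  ⊸e₁ : ∀ {Θ Γ Δ A C} (d : Γ ⊢ A) (e : Δ ⊢ A ⊸ C) (i : Θ ≅ (Γ ,, Δ)) → Premise ⌜ d ⌝ ⌜ ⊸e d e i ⌝
  ⊸e₂ : ∀ {Θ Γ Δ A C} (d : Γ ⊢ A) (e : Δ ⊢ A ⊸ C) (i : Θ ≅ (Γ ,, Δ)) → Premise ⌜ e ⌝ ⌜ ⊸e d e i ⌝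
  ⧹i₁ : ∀ {Γ A C} (d : ⟨ [ A ] ⨾ Γ ⟩ ⊢ C) → Premise ⌜ d ⌝ ⌜ ⧹i d ⌝
  ⧸i₁ : ∀ {Γ A C} (d : ⟨ Γ ⨾ [ A ] ⟩ ⊢ C) → Premise ⌜ d ⌝ ⌜ ⧸i d ⌝
  ⊸i₁ : ∀ {Γ A C} (d : ([ A ] ,, Γ) ⊢ C) → Premise ⌜ d ⌝ ⌜ ⊸i d ⌝
  ⊙i₁ : ∀ {Θ Γ Δ A B} (d : Δ ⊢ A) (e : Γ ⊢ B) (i : Θ ≅ ⟨ Δ ⨾ Γ ⟩) → Premise ⌜ d ⌝ ⌜ ⊙i d e i ⌝
  ⊙i₂ : ∀ {Θ Γ Δ A B} (d : Δ ⊢ A) (e : Γ ⊢ B) (i : Θ ≅ ⟨ Δ ⨾ Γ ⟩) → Premise ⌜ e ⌝ ⌜ ⊙i d e i ⌝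
  ⊗i₁ : ∀ {Θ Γ Δ A B} (d : Δ ⊢ A) (e : Γ ⊢ B) (i : Θ ≅ (Δ ,, Γ)) → Premise ⌜ d ⌝ ⌜ ⊗i d e i ⌝
  ⊗i₂ : ∀ {Θ Γ Δ A B} (d : Δ ⊢ A) (e : Γ ⊢ B) (i : Θ ≅ (Δ ,, Γ)) → Premise ⌜ e ⌝ ⌜ ⊗i d e i ⌝
  ⊙e₁ : ∀ {Θ Δ A B C} (Γ : Ctx□) (d : Δ ⊢ A ⊙ B) (e : Γ [ ⟨ [ A ] ⨾ [ B ] ⟩ ]□ ⊢ C)
        (i : Θ ≅ Γ [ Δ ]□) → Premise ⌜ d ⌝ ⌜ ⊙e Γ d e i ⌝
  ⊙e₂ : ∀ {Θ Δ A B C} (Γ : Ctx□) (d : Δ ⊢ A ⊙ B) (e : Γ [ ⟨ [ A ] ⨾ [ B ] ⟩ ]□ ⊢ C)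
        (i : Θ ≅ Γ [ Δ ]□) → Premise ⌜ e ⌝ ⌜ ⊙e Γ d e i ⌝
  ⊗e₁ : ∀ {Θ Δ A B C} (Γ : Ctx□) (d : Δ ⊢ A ⊗ B) (e : Γ [ [ A ] ,, [ B ] ]□ ⊢ C)
        (i : Θ ≅ Γ [ Δ ]□) → Premise ⌜ d ⌝ ⌜ ⊗e Γ d e i ⌝
  ⊗e₂ : ∀ {Θ Δ A B C} (Γ : Ctx□) (d : Δ ⊢ A ⊗ B) (e : Γ [ [ A ] ,, [ B ] ]□ ⊢ C)
        (i : Θ ≅ Γ [ Δ ]□) → Premise ⌜ e ⌝ ⌜ ⊗e Γ d e i ⌝
  ent₁ : ∀ {Θ Γ C} (d : Γ ⊢ C) (w : Θ ⊑ Γ) → Premise ⌜ d ⌝ ⌜ ent d w ⌝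

-- SubProof S δ : S is a sequent (occurrence) of the proof δ
SubProof : Deriv → Deriv → Set
SubProof = Star Premise

data Major : Deriv → Deriv → Set where
  ⧹e-maj : ∀ {Θ Γ Δ A C} (d : Γ ⊢ A) (e : Δ ⊢ A ⧹ C) (i : Θ ≅ ⟨ Γ ⨾ Δ ⟩) → Major ⌜ ⧹e d e i ⌝ ⌜ e ⌝
  ⧸e-maj : ∀ {Θ Γ Δ A C} (e : Δ ⊢ C ⧸ A) (d : Γ ⊢ A) (i : Θ ≅ ⟨ Δ ⨾ Γ ⟩) → Major ⌜ ⧸e e d i ⌝ ⌜ e ⌝
  ⊸e-maj : ∀ {Θ Γ Δ A C} (d : Γ ⊢ A) (e : Δ ⊢ A ⊸ C) (i : Θ ≅ (Γ ,, Δ)) → Major ⌜ ⊸e d e i ⌝ ⌜ e ⌝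
  ⊙e-maj : ∀ {Θ Δ A B C} (Γ : Ctx□) (d : Δ ⊢ A ⊙ B) (e : Γ [ ⟨ [ A ] ⨾ [ B ] ⟩ ]□ ⊢ C)
           (i : Θ ≅ Γ [ Δ ]□) → Major ⌜ ⊙e Γ d e i ⌝ ⌜ d ⌝
  ⊗e-maj : ∀ {Θ Δ A B C} (Γ : Ctx□) (d : Δ ⊢ A ⊗ B) (e : Γ [ [ A ] ,, [ B ] ]□ ⊢ C)
           (i : Θ ≅ Γ [ Δ ]□) → Major ⌜ ⊗e Γ d e i ⌝ ⌜ d ⌝

-- BStep S S' : S' is the premise, belonging to the principal branch, of the
-- rule concluding S (so that B(S₀) = { S | Star BStep S₀ S })
data BStep : Deriv → Deriv → Set where
  ⧹e-b : ∀ {Θ Γ Δ A C} (d : Γ ⊢ A) (e : Δ ⊢ A ⧹ C) (i : Θ ≅ ⟨ Γ ⨾ Δ ⟩) → BStep ⌜ ⧹e d e i ⌝ ⌜ e ⌝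
  ⧸e-b : ∀ {Θ Γ Δ A C} (e : Δ ⊢ C ⧸ A) (d : Γ ⊢ A) (i : Θ ≅ ⟨ Δ ⨾ Γ ⟩) → BStep ⌜ ⧸e e d i ⌝ ⌜ e ⌝
  ⊸e-b : ∀ {Θ Γ Δ A C} (d : Γ ⊢ A) (e : Δ ⊢ A ⊸ C) (i : Θ ≅ (Γ ,, Δ)) → BStep ⌜ ⊸e d e i ⌝ ⌜ e ⌝
  ⧹i-b : ∀ {Γ A C} (d : ⟨ [ A ] ⨾ Γ ⟩ ⊢ C) → BStep ⌜ ⧹i d ⌝ ⌜ d ⌝
  ⧸i-b : ∀ {Γ A C} (d : ⟨ Γ ⨾ [ A ] ⟩ ⊢ C) → BStep ⌜ ⧸i d ⌝ ⌜ d ⌝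
  ⊸i-b : ∀ {Γ A C} (d : ([ A ] ,, Γ) ⊢ C) → BStep ⌜ ⊸i d ⌝ ⌜ d ⌝
  ⊙e-b : ∀ {Θ Δ A B C} (Γ : Ctx□) (d : Δ ⊢ A ⊙ B) (e : Γ [ ⟨ [ A ] ⨾ [ B ] ⟩ ]□ ⊢ C)
         (i : Θ ≅ Γ [ Δ ]□) → BStep ⌜ ⊙e Γ d e i ⌝ ⌜ e ⌝
  ⊗e-b : ∀ {Θ Δ A B C} (Γ : Ctx□) (d : Δ ⊢ A ⊗ B) (e : Γ [ [ A ] ,, [ B ] ]□ ⊢ C)
         (i : Θ ≅ Γ [ Δ ]□) → BStep ⌜ ⊗e Γ d e i ⌝ ⌜ e ⌝
  ent-b : ∀ {Θ Γ C} (d : Γ ⊢ C) (w : Θ ⊑ Γ) → BStep ⌜ ent d w ⌝ ⌜ d ⌝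

data IsIntro : Deriv → Set where
  ⧹i-I : ∀ {Γ A C} (d : ⟨ [ A ] ⨾ Γ ⟩ ⊢ C) → IsIntro ⌜ ⧹i d ⌝
  ⧸i-I : ∀ {Γ A C} (d : ⟨ Γ ⨾ [ A ] ⟩ ⊢ C) → IsIntro ⌜ ⧸i d ⌝
  ⊸i-I : ∀ {Γ A C} (d : ([ A ] ,, Γ) ⊢ C) → IsIntro ⌜ ⊸i d ⌝
  ⊙i-I : ∀ {Θ Γ Δ A B} (d : Δ ⊢ A) (e : Γ ⊢ B) (i : Θ ≅ ⟨ Δ ⨾ Γ ⟩) → IsIntro ⌜ ⊙i d e i ⌝
  ⊗i-I : ∀ {Θ Γ Δ A B} (d : Δ ⊢ A) (e : Γ ⊢ B) (i : Θ ≅ (Δ ,, Γ)) → IsIntro ⌜ ⊗i d e i ⌝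

-- S is concluded by an elimination rule which is the end of a
-- k-extended-redex (for some k ≥ 0): its major premise S₀ starts a path
-- S₀,…,S_k in B(S₀) ending in the conclusion S_k of an introduction, with
-- S₀ and S_k having the same right-hand formula.
ExtRedex : Deriv → Set
ExtRedex S = ∃[ S₀ ] ∃[ Sₖ ] (Major S S₀ × Star BStep S₀ Sₖ × IsIntro Sₖ × rhs S₀ ≡ rhs Sₖ)

Normal : ∀ {Γ C} → Γ ⊢ C → Set
Normal δ = ∀ S → SubProof S ⌜ δ ⌝ → ¬ ExtRedex S

SubformulaOf : Formula → Ctx → Formula → Set
SubformulaOf F Γ C = (Σ[ p ∈ Pos Γ ] (F ⊑f lbl p)) ⊎ (F ⊑f C)

module Submission where

open import Defs
open import Data.Product using (_×_; Σ-syntax; ∃-syntax; _,_)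
open import Data.Sum using (_⊎_; inj₁; inj₂)
open import Data.Empty using (⊥-elim)
open import Function using (_∘_)
open import Relation.Nullary using (¬_)
open import Relation.Binary.PropositionalEquality using (_≡_; refl; sym; trans; cong; subst)
open import Relation.Binary.Construct.Closure.ReflexiveTransitive using (Star; ε; _◅_; _◅◅_)

-- In a normal proof the principal branch of a sequent Δ ⊢ F either reaches an
-- introduction of F, or F is a sub-formula of a formula of Δ; normality forbids
-- the first case below the major premise of an elimination. Hence along every
-- rule, read from conclusion to premise, the formulas of the premise are
-- sub-formulas of those of the conclusion, and the theorem follows by
-- composing along the path from δ' down to δ.

⊑f-trans : ∀ {A B C} → A ⊑f B → B ⊑f C → A ⊑f C
⊑f-trans p sf-refl   = p
⊑f-trans p (sf-⊗l q) = sf-⊗l (⊑f-trans p q)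
⊑f-trans p (sf-⊗r q) = sf-⊗r (⊑f-trans p q)
⊑f-trans p (sf-⊙l q) = sf-⊙l (⊑f-trans p q)
⊑f-trans p (sf-⊙r q) = sf-⊙r (⊑f-trans p q)
⊑f-trans p (sf-⊸l q) = sf-⊸l (⊑f-trans p q)
⊑f-trans p (sf-⊸r q) = sf-⊸r (⊑f-trans p q)
⊑f-trans p (sf-⧹l q) = sf-⧹l (⊑f-trans p q)
⊑f-trans p (sf-⧹r q) = sf-⧹r (⊑f-trans p q)
⊑f-trans p (sf-⧸l q) = sf-⧸l (⊑f-trans p q)
⊑f-trans p (sf-⧸r q) = sf-⧸r (⊑f-trans p q)

infix 4 _∈sf_ _⊆sf_

_∈sf_ : Formula → Ctx → Set
F ∈sf Γ = Σ[ p ∈ Pos Γ ] (F ⊑f lbl p)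

_⊆sf_ : Ctx → Ctx → Set
Γ ⊆sf Δ = (p : Pos Γ) → lbl p ∈sf Δ

⊆sf-refl : ∀ {Γ} → Γ ⊆sf Γ
⊆sf-refl p = p , sf-refl

∈sf-⊆sf : ∀ {F Γ Δ} → F ∈sf Γ → Γ ⊆sf Δ → F ∈sf Δ
∈sf-⊆sf (p , F⊑p) Γ⊆Δ with Γ⊆Δ p
... | q , p⊑q = q , ⊑f-trans F⊑p p⊑q

⊆sf-trans : ∀ {Γ Δ Ξ} → Γ ⊆sf Δ → Δ ⊆sf Ξ → Γ ⊆sf Ξ
⊆sf-trans Γ⊆Δ Δ⊆Ξ p = ∈sf-⊆sf (Γ⊆Δ p) Δ⊆Ξ

⊑f-∈sf : ∀ {F G Γ} → F ⊑f G → G ∈sf Γ → F ∈sf Γ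
⊑f-∈sf F⊑G (p , G⊑p) = p , ⊑f-trans F⊑G G⊑p

⊆sf-seqL : ∀ {Γ Δ} → Γ ⊆sf ⟨ Γ ⨾ Δ ⟩
⊆sf-seqL p = seqL p , sf-refl

⊆sf-seqR : ∀ {Γ Δ} → Δ ⊆sf ⟨ Γ ⨾ Δ ⟩
⊆sf-seqR p = seqR p , sf-refl

⊆sf-parL : ∀ {Γ Δ} → Γ ⊆sf (Γ ,, Δ)
⊆sf-parL p = parL p , sf-refl

⊆sf-parR : ∀ {Γ Δ} → Δ ⊆sf (Γ ,, Δ)
⊆sf-parR p = parR p , sf-refl

⊑⇒⊇sf : ∀ {Θ Γ} → Θ ⊑ Γ → Γ ⊆sf Θ
⊑⇒⊇sf w q = from q , subst (lbl q ⊑f_) lbl-from sf-refl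
  where
  open _⊑_ w
  lbl-from : lbl q ≡ lbl (from q)
  lbl-from = trans (cong lbl (sym (to-from q))) (lbl-to (from q))

≅⇒⊇sf : ∀ {Θ Γ} → Θ ≅ Γ → Γ ⊆sf Θ
≅⇒⊇sf i = ⊑⇒⊇sf (_≅_.incl i)

⊆sf-hole : ∀ (G : Ctx□) {Δ} → Δ ⊆sf G [ Δ ]□
⊆sf-hole □           = ⊆sf-refl
⊆sf-hole (parL□ G _) = ⊆sf-trans (⊆sf-hole G) ⊆sf-parL
⊆sf-hole (parR□ _ G) = ⊆sf-trans (⊆sf-hole G) ⊆sf-parR
⊆sf-hole (seqL□ G _) = ⊆sf-trans (⊆sf-hole G) ⊆sf-seqL
⊆sf-hole (seqR□ _ G) = ⊆sf-trans (⊆sf-hole G) ⊆sf-seqR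

⊆sf-fill : ∀ (G : Ctx□) {X Y} → X ⊆sf Y → G [ X ]□ ⊆sf G [ Y ]□
⊆sf-fill □           X⊆Y p        = X⊆Y p
⊆sf-fill (parL□ G _) X⊆Y (parL p) = ∈sf-⊆sf (⊆sf-fill G X⊆Y p) ⊆sf-parL
⊆sf-fill (parL□ G _) X⊆Y (parR p) = ⊆sf-parR p
⊆sf-fill (parR□ _ G) X⊆Y (parL p) = ⊆sf-parL p
⊆sf-fill (parR□ _ G) X⊆Y (parR p) = ∈sf-⊆sf (⊆sf-fill G X⊆Y p) ⊆sf-parR
⊆sf-fill (seqL□ G _) X⊆Y (seqL p) = ∈sf-⊆sf (⊆sf-fill G X⊆Y p) ⊆sf-seqL
⊆sf-fill (seqL□ G _) X⊆Y (seqR p) = ⊆sf-seqR p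
⊆sf-fill (seqR□ _ G) X⊆Y (seqL p) = ⊆sf-seqL p
⊆sf-fill (seqR□ _ G) X⊆Y (seqR p) = ∈sf-⊆sf (⊆sf-fill G X⊆Y p) ⊆sf-seqR

⊙-parts-⊆sf : ∀ {A B Δ} → A ⊙ B ∈sf Δ → ⟨ [ A ] ⨾ [ B ] ⟩ ⊆sf Δ
⊙-parts-⊆sf A⊙B (seqL here) = ⊑f-∈sf (sf-⊙l sf-refl) A⊙B
⊙-parts-⊆sf A⊙B (seqR here) = ⊑f-∈sf (sf-⊙r sf-refl) A⊙B

⊗-parts-⊆sf : ∀ {A B Δ} → A ⊗ B ∈sf Δ → ([ A ] ,, [ B ]) ⊆sf Δ
⊗-parts-⊆sf A⊗B (parL here) = ⊑f-∈sf (sf-⊗l sf-refl) A⊗B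
⊗-parts-⊆sf A⊗B (parR here) = ⊑f-∈sf (sf-⊗r sf-refl) A⊗B

IsNormal : Deriv → Set
IsNormal T = ∀ S → SubProof S T → ¬ ExtRedex S

IsNormal-subProof : ∀ {S T} → SubProof S T → IsNormal T → IsNormal S
IsNormal-subProof S⊆T n U U⊆S = n U (U⊆S ◅◅ S⊆T)

IsNormal-premise : ∀ {S T} → Premise S T → IsNormal T → IsNormal S
IsNormal-premise p = IsNormal-subProof (p ◅ ε)

HasIntroBranch : Deriv → Set
HasIntroBranch S = ∃[ Sₖ ] (Star BStep S Sₖ × IsIntro Sₖ × rhs S ≡ rhs Sₖ)

HasIntroBranch-step : ∀ {S S'} → BStep S S' → rhs S ≡ rhs S' → HasIntroBranch S' → HasIntroBranch S
HasIntroBranch-step b eq (Sₖ , path , intro , eq') = Sₖ , b ◅ path , intro , trans eq eq'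

major⇒premise : ∀ {T S} → Major T S → Premise S T
major⇒premise (⧹e-maj d e i)   = ⧹e₂ d e i
major⇒premise (⧸e-maj e d i)   = ⧸e₁ e d i
major⇒premise (⊸e-maj d e i)   = ⊸e₂ d e i
major⇒premise (⊙e-maj G d e i) = ⊙e₁ G d e i
major⇒premise (⊗e-maj G d e i) = ⊗e₁ G d e i

major-¬HasIntroBranch : ∀ {T S} → IsNormal T → Major T S → ¬ HasIntroBranch S
major-¬HasIntroBranch {T} n m (Sₖ , path , intro , eq) = n T ε (_ , Sₖ , m , path , intro , eq)

major-rhs : ∀ {T Δ F} {e : Δ ⊢ F} → IsNormal T → Major T ⌜ e ⌝ → F ∈sf Δ

HasIntroBranch⊎rhs-∈sf : ∀ {Δ F} (d : Δ ⊢ F) → IsNormal ⌜ d ⌝ → HasIntroBranch ⌜ d ⌝ ⊎ F ∈sf Δ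
HasIntroBranch⊎rhs-∈sf (ax i) n = inj₂ (≅⇒⊇sf i here)
HasIntroBranch⊎rhs-∈sf (⧹e d e i) n =
  inj₂ (∈sf-⊆sf (⊑f-∈sf (sf-⧹r sf-refl) (major-rhs n (⧹e-maj d e i)))
                (≅⇒⊇sf i ∘ seqR))
HasIntroBranch⊎rhs-∈sf (⧸e e d i) n =
  inj₂ (∈sf-⊆sf (⊑f-∈sf (sf-⧸l sf-refl) (major-rhs n (⧸e-maj e d i)))
                (≅⇒⊇sf i ∘ seqL))
HasIntroBranch⊎rhs-∈sf (⊸e d e i) n =
  inj₂ (∈sf-⊆sf (⊑f-∈sf (sf-⊸r sf-refl) (major-rhs n (⊸e-maj d e i)))
                (≅⇒⊇sf i ∘ parR))
HasIntroBranch⊎rhs-∈sf (⧹i d)       n = inj₁ (_ , ε , ⧹i-I d , refl)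
HasIntroBranch⊎rhs-∈sf (⧸i d)       n = inj₁ (_ , ε , ⧸i-I d , refl)
HasIntroBranch⊎rhs-∈sf (⊸i d)       n = inj₁ (_ , ε , ⊸i-I d , refl)
HasIntroBranch⊎rhs-∈sf (⊙i d e i)   n = inj₁ (_ , ε , ⊙i-I d e i , refl)
HasIntroBranch⊎rhs-∈sf (⊗i d e i)   n = inj₁ (_ , ε , ⊗i-I d e i , refl)
HasIntroBranch⊎rhs-∈sf (⊙e G d e i) n
  with HasIntroBranch⊎rhs-∈sf e (IsNormal-premise (⊙e₂ G d e i) n)
... | inj₁ b = inj₁ (HasIntroBranch-step (⊙e-b G d e i) refl b)
... | inj₂ s = inj₂ (∈sf-⊆sf s (⊆sf-trans (⊆sf-fill G (⊙-parts-⊆sf A⊙B)) (≅⇒⊇sf i)))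
  where A⊙B = major-rhs n (⊙e-maj G d e i)
HasIntroBranch⊎rhs-∈sf (⊗e G d e i) n
  with HasIntroBranch⊎rhs-∈sf e (IsNormal-premise (⊗e₂ G d e i) n)
... | inj₁ b = inj₁ (HasIntroBranch-step (⊗e-b G d e i) refl b)
... | inj₂ s = inj₂ (∈sf-⊆sf s (⊆sf-trans (⊆sf-fill G (⊗-parts-⊆sf A⊗B)) (≅⇒⊇sf i)))
  where A⊗B = major-rhs n (⊗e-maj G d e i)
HasIntroBranch⊎rhs-∈sf (ent d w) n
  with HasIntroBranch⊎rhs-∈sf d (IsNormal-premise (ent₁ d w) n)
... | inj₁ b = inj₁ (HasIntroBranch-step (ent-b d w) refl b)
... | inj₂ s = inj₂ (∈sf-⊆sf s (⊑⇒⊇sf w))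

major-rhs {e = e} n m with HasIntroBranch⊎rhs-∈sf e (IsNormal-premise (major⇒premise m) n)
... | inj₁ b = ⊥-elim (major-¬HasIntroBranch n m b)
... | inj₂ s = s

infix 4 _≼_

_≼_ : Deriv → Deriv → Set
(Θ , D , _) ≼ (Γ , C , _) = ((q : Pos Θ) → SubformulaOf (lbl q) Γ C) × SubformulaOf D Γ C

SubformulaOf-⊑f : ∀ {F G Γ C} → F ⊑f G → SubformulaOf G Γ C → SubformulaOf F Γ C
SubformulaOf-⊑f F⊑G (inj₁ G∈Γ) = inj₁ (⊑f-∈sf F⊑G G∈Γ)
SubformulaOf-⊑f F⊑G (inj₂ G⊑C) = inj₂ (⊑f-trans F⊑G G⊑C)

SubformulaOf-trans : ∀ {F Γ′ C′ Γ C} → SubformulaOf F Γ′ C′ →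
  ((q : Pos Γ′) → SubformulaOf (lbl q) Γ C) → SubformulaOf C′ Γ C → SubformulaOf F Γ C
SubformulaOf-trans (inj₁ (q , F⊑q)) Γ′≼ C′≼ = SubformulaOf-⊑f F⊑q (Γ′≼ q)
SubformulaOf-trans (inj₂ F⊑C′)      Γ′≼ C′≼ = SubformulaOf-⊑f F⊑C′ C′≼

≼-refl : ∀ {S} → S ≼ S
≼-refl {_ , _ , _} = (λ q → inj₁ (q , sf-refl)) , inj₂ sf-refl

≼-trans : ∀ {S U T} → S ≼ U → U ≼ T → S ≼ T
≼-trans {_ , _ , _} {_ , _ , _} {_ , _ , _} (Θ≼ , D≼) (Γ′≼ , C′≼) =
  (λ q → SubformulaOf-trans (Θ≼ q) Γ′≼ C′≼) , SubformulaOf-trans D≼ Γ′≼ C′≼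

premise-≼ : ∀ {S T} → Premise S T → IsNormal T → S ≼ T
premise-≼ (⧹e₁ d e i) n = inj₁ ∘ ≅⇒⊇sf i ∘ seqL ,
  inj₁ (∈sf-⊆sf (⊑f-∈sf (sf-⧹l sf-refl) (major-rhs n (⧹e-maj d e i))) (≅⇒⊇sf i ∘ seqR))
premise-≼ (⧹e₂ d e i) n = inj₁ ∘ ≅⇒⊇sf i ∘ seqR ,
  inj₁ (∈sf-⊆sf (major-rhs n (⧹e-maj d e i)) (≅⇒⊇sf i ∘ seqR))
premise-≼ (⧸e₁ e d i) n = inj₁ ∘ ≅⇒⊇sf i ∘ seqL ,
  inj₁ (∈sf-⊆sf (major-rhs n (⧸e-maj e d i)) (≅⇒⊇sf i ∘ seqL))
premise-≼ (⧸e₂ e d i) n = inj₁ ∘ ≅⇒⊇sf i ∘ seqR ,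
  inj₁ (∈sf-⊆sf (⊑f-∈sf (sf-⧸r sf-refl) (major-rhs n (⧸e-maj e d i))) (≅⇒⊇sf i ∘ seqL))
premise-≼ (⊸e₁ d e i) n = inj₁ ∘ ≅⇒⊇sf i ∘ parL ,
  inj₁ (∈sf-⊆sf (⊑f-∈sf (sf-⊸l sf-refl) (major-rhs n (⊸e-maj d e i))) (≅⇒⊇sf i ∘ parR))
premise-≼ (⊸e₂ d e i) n = inj₁ ∘ ≅⇒⊇sf i ∘ parR ,
  inj₁ (∈sf-⊆sf (major-rhs n (⊸e-maj d e i)) (≅⇒⊇sf i ∘ parR))
premise-≼ (⧹i₁ d) n = hyps , inj₂ (sf-⧹r sf-refl)
  where
  hyps : (q : Pos ⟨ [ _ ] ⨾ _ ⟩) → SubformulaOf (lbl q) _ _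
  hyps (seqL here) = inj₂ (sf-⧹l sf-refl)
  hyps (seqR q)    = inj₁ (q , sf-refl)
premise-≼ (⧸i₁ d) n = hyps , inj₂ (sf-⧸l sf-refl)
  where
  hyps : (q : Pos ⟨ _ ⨾ [ _ ] ⟩) → SubformulaOf (lbl q) _ _
  hyps (seqL q)    = inj₁ (q , sf-refl)
  hyps (seqR here) = inj₂ (sf-⧸r sf-refl)
premise-≼ (⊸i₁ d) n = hyps , inj₂ (sf-⊸r sf-refl)
  where
  hyps : (q : Pos ([ _ ] ,, _)) → SubformulaOf (lbl q) _ _
  hyps (parL here) = inj₂ (sf-⊸l sf-refl)
  hyps (parR q)    = inj₁ (q , sf-refl)
premise-≼ (⊙i₁ d e i) n = inj₁ ∘ ≅⇒⊇sf i ∘ seqL , inj₂ (sf-⊙l sf-refl)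
premise-≼ (⊙i₂ d e i) n = inj₁ ∘ ≅⇒⊇sf i ∘ seqR , inj₂ (sf-⊙r sf-refl)
premise-≼ (⊗i₁ d e i) n = inj₁ ∘ ≅⇒⊇sf i ∘ parL , inj₂ (sf-⊗l sf-refl)
premise-≼ (⊗i₂ d e i) n = inj₁ ∘ ≅⇒⊇sf i ∘ parR , inj₂ (sf-⊗r sf-refl)
premise-≼ (⊙e₁ G d e i) n = inj₁ ∘ Δ⊆Θ , inj₁ (∈sf-⊆sf (major-rhs n (⊙e-maj G d e i)) Δ⊆Θ)
  where Δ⊆Θ = ⊆sf-trans (⊆sf-hole G) (≅⇒⊇sf i)
premise-≼ (⊙e₂ G d e i) n = inj₁ ∘ ⊆sf-trans (⊆sf-fill G A⨾B⊆Δ) (≅⇒⊇sf i) , inj₂ sf-refl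
  where A⨾B⊆Δ = ⊙-parts-⊆sf (major-rhs n (⊙e-maj G d e i))
premise-≼ (⊗e₁ G d e i) n = inj₁ ∘ Δ⊆Θ , inj₁ (∈sf-⊆sf (major-rhs n (⊗e-maj G d e i)) Δ⊆Θ)
  where Δ⊆Θ = ⊆sf-trans (⊆sf-hole G) (≅⇒⊇sf i)
premise-≼ (⊗e₂ G d e i) n = inj₁ ∘ ⊆sf-trans (⊆sf-fill G A,B⊆Δ) (≅⇒⊇sf i) , inj₂ sf-refl
  where A,B⊆Δ = ⊗-parts-⊆sf (major-rhs n (⊗e-maj G d e i))
premise-≼ (ent₁ d w) n = inj₁ ∘ ⊑⇒⊇sf w , inj₂ sf-refl

subProof-≼ : ∀ {S T} → SubProof S T → IsNormal T → S ≼ T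
subProof-≼ {S} ε n = ≼-refl {S}
subProof-≼ {S} {T} (_◅_ {j = U} p ps) n =
  ≼-trans {S} {U} {T} (premise-≼ p (IsNormal-subProof ps n)) (subProof-≼ ps n)

mainTheorem4 : ∀ {Γ C} (δ : Γ ⊢ C) → Normal δ →
    ∀ {Θ D} (δ' : Θ ⊢ D) → SubProof ⌜ δ' ⌝ ⌜ δ ⌝ →
    ((q : Pos Θ) → SubformulaOf (lbl q) Γ C) × SubformulaOf D Γ C
mainTheorem4 δ normal δ' δ'∈δ = subProof-≼ δ'∈δ normal
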